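{- Let $E,E'\in\mathcal P^e$ with $E\xrightarrow{\mu}E'$, and let $\langle s,n\rangle\in lab(E)$ with $\langle s,n\rangle\notin lab(E')$. Then $\langle s,n\rangle\in top(E)$.
   Context: Unlabeled processes. Let $\mathcal N$ be an infinite set of names. The set $\mathcal P$ of processes is generated by $P::=0\mid x(y).P\mid \bar xy.P\mid P\,|\,P\mid(\nu x)P\mid\, !P$; binders, $fn$, $bn$, $n(\cdot)$ as usual (alpha-conversion assumed). Actions $\mu$: $xy$, $\bar xy$, $\bar x(y)$, $\tau$, with $bn(\bar x(y))=\{y\}$, otherwise empty, $fn(xy)=fn(\bar xy)=\{x,y\}$, $fn(\bar x(y))=\{x\}$, $fn(\tau)=\emptyset$. The (early) transition relation is the least relation closed under: Input $x(y).P\xrightarrow{xz}P\{z/y\}$; Output $\bar xy.P\xrightarrow{\bar xy}P$; Open: $P\xrightarrow{\bar xy}P'$, $x\ne y$ imply $(\nu y)P\xrightarrow{\bar x(y)}P'$; Res: $P\xrightarrow{\mu}P'$, $y\notin n(\mu)$ imply $(\nu y)P\xrightarrow{\mu}(\nu y)P'$; Par: $P\xrightarrow{\mu}P'$, $bn(\mu)\cap fn(Q)=\emptyset$ imply $P|Q\xrightarrow{\mu}P'|Q$; Com: $P\xrightarrow{xy}P'$, $Q\xrightarrow{\bar xy}Q'$ imply $P|Q\xrightarrow{\tau}P'|Q'$; Close: $P\xrightarrow{xy}P'$, $Q\xrightarrow{\bar x(y)}Q'$, $y\notin fn(P)$ imply $P|Q\xrightarrow{\tau}(\nu y)(P'|Q')$;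 symmetric versions of Par, Com, Close; Rep: $P\xrightarrow{\mu}P'$ implies $!P\xrightarrow{\mu}P'|!P$. Labeled terms. Labels are pairs $\langle s,n\rangle\in\{0,1\}^*\times\mathbb N$; $s_0\sqsubseteq s_1$ means $s_0$ is a prefix of $s_1$; for label sets, $L_0\,\Re\,L_1$ iff for all $\langle s_0,n_0\rangle\in L_0$, $\langle s_1,n_1\rangle\in L_1$: $s_0\not\sqsubseteq s_1$ and $s_1\not\sqsubseteq s_0$. Ground labeled terms $\mathcal P^e_{gr}$: $E::=0\mid \mu_{\langle s,n\rangle}.E\mid(\nu x)E\mid E\,|\,E\mid\, !_{\langle s,n\rangle}P$, with $\mu$ a prefix $x(y)$ or $\bar xy$ and $P\in\mathcal P$ unlabeled. Labeling function: $L_{\langle s,n\rangle}(0)=0$; $L_{\langle s,n\rangle}(\mu.P)=\mu_{\langle s,n\rangle}.L_{\langle s,n+1\rangle}(P)$; $L_{\langle s,n\rangle}(P_0|P_1)=L_{\langle s0,n\rangle}(P_0)\,|\,L_{\langle s1,n\rangle}(P_1)$; $L_{\langle s,n\rangle}((\nu x)P)=(\nu x)L_{\langle s,n\rangle}(P)$; $L_{\langle s,n\rangle}(!P)=\,!_{\langle s,n\rangle}P$. $top(0)=lab(0)=\emptyset$; $top(\mu_v.E)=\{v\}$, $lab(\mu_v.E)=\{v\}\cup lab(E)$; $top,lab$ of $(\nu x)E$ equal those of $E$; $top(E_0|E_1)=top(E_0)\cup top(E_1)$, $lab(E_0|E_1)=lab(E_0)\cup lab(E_1)$; $top(!_vP)=lab(!_vP)=\{v\}$.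 $wf$ is the least predicate with: $wf(0)$; $wf(L_{\langle s,n\rangle}(\mu.P))$ for every $\mu.P\in\mathcal P$ and label; $wf(E_0|E_1)$ if $wf(E_0)$, $wf(E_1)$, $top(E_0)\,\Re\,top(E_1)$; $wf((\nu x)E)$ if $wf(E)$; $wf(!_{\langle s,n\rangle}P)$ for every $P\in\mathcal P$ and label. $\mathcal P^e=\{E\in\mathcal P^e_{gr}:wf(E)\}$. Labeled transitions use the unlabeled rules with labels ignored (e.g. $x(y)_v.E\xrightarrow{xz}E\{z/y\}$, substitution not affecting labels; $\bar xy_v.E\xrightarrow{\bar xy}E$), except replication: if $P\xrightarrow{\mu}P'$ (unlabeled) then $!_{\langle s,n\rangle}P\xrightarrow{\mu}L_{\langle s0,n+1\rangle}(P')\,|\,!_{\langle s1,n+1\rangle}P$. -}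

module Defs where

open import Data.Nat using (ℕ; zero; suc; _⊔_; _≟_)
open import Data.Bool using (Bool; true; false; if_then_else_)
open import Data.List using (List; []; _∷_; _++_; [_]; foldr; map)
open import Data.List.Membership.Propositional using (_∈_; _∉_)
open import Data.Product using (_×_; _,_; ∃)
open import Relation.Nullary using (¬_; does)
open import Relation.Binary.PropositionalEquality using (_≡_)

Name : Set
Name = ℕ

remove : Name → List Name → List Name
remove y [] = []
remove y (z ∷ zs) = if does (z ≟ y) then remove y zs else z ∷ remove y zs

data Act : Set where
  inA  : Name → Name → Act
  outA : Name → Name → Act
  boutA : Name → Name → Act
  τ    : Act

bnA : Act → List Name
bnA (boutA x y) = [ y ]
bnA _ = []

fnA : Act → List Name
fnA (inA x y) = x ∷ y ∷ []
fnA (outA x y) = x ∷ y ∷ []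
fnA (boutA x y) = [ x ]
fnA τ = []

nA : Act → List Name
nA μ = fnA μ ++ bnA μ

data Prefix : Set where
  inP  : Name → Name → Prefix
  outP : Name → Name → Prefix

data Proc : Set where
  𝟘    : Proc
  pre  : Prefix → Proc → Proc
  _∣_  : Proc → Proc → Proc
  ν    : Name → Proc → Proc
  !_   : Proc → Proc

fn : Proc → List Name
fn 𝟘 = []
fn (pre (inP x y) P) = x ∷ remove y (fn P)
fn (pre (outP x y) P) = x ∷ y ∷ fn P
fn (P ∣ Q) = fn P ++ fn Q
fn (ν x P) = remove x (fn P)
fn (! P) = fn P

-- Capture-avoiding simultaneous substitution (bound names are renamed
-- to a fresh name, i.e. a name larger than every image of a free name).

Subst : Set
Subst = Name → Name

fresh : Subst → List Name → Name
fresh σ xs = suc (foldr _⊔_ 0 (map σ xs))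

update : Subst → Name → Name → Subst
update σ x w z = if does (z ≟ x) then w else σ z

idS : Subst
idS z = z

sub : Subst → Proc → Proc
sub σ 𝟘 = 𝟘
sub σ (pre (inP x y) P) =
  let w = fresh σ (fn (pre (inP x y) P)) in pre (inP (σ x) w) (sub (update σ y w) P)
sub σ (pre (outP x y) P) = pre (outP (σ x) (σ y)) (sub σ P)
sub σ (P ∣ Q) = sub σ P ∣ sub σ Q
sub σ (ν x P) =
  let w = fresh σ (fn (ν x P)) in ν w (sub (update σ x w) P)
sub σ (! P) = ! (sub σ P)

_[_/_] : Proc → Name → Name → Proc
P [ z / y ] = sub (update idS y z) P

infix 4 _≈P_
data _≈P_ : Proc → Proc → Set where
  ≈refl  : ∀ {P} → P ≈P P
  ≈sym   : ∀ {P Q} → P ≈P Q → Q ≈P P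
  ≈trans : ∀ {P Q R} → P ≈P Q → Q ≈P R → P ≈P R
  ≈pre   : ∀ {π P Q} → P ≈P Q → pre π P ≈P pre π Q
  ≈par   : ∀ {P P' Q Q'} → P ≈P P' → Q ≈P Q' → (P ∣ Q) ≈P (P' ∣ Q')
  ≈ν     : ∀ {x P Q} → P ≈P Q → ν x P ≈P ν x Q
  ≈!     : ∀ {P Q} → P ≈P Q → (! P) ≈P (! Q)
  α-ν    : ∀ {x y P} → y ∉ fn (ν x P) → ν x P ≈P ν y (P [ y / x ])
  α-in   : ∀ {x y z P} → z ∉ fn (pre (inP x y) P) →
           pre (inP x y) P ≈P pre (inP x z) (P [ z / y ])

infix 3 _─[_]→_
data _─[_]→_ : Proc → Act → Proc → Set where
  Input  : ∀ {x y z P} → pre (inP x y) P ─[ inA x z ]→ (P [ z / y ])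
  Output : ∀ {x y P} → pre (outP x y) P ─[ outA x y ]→ P
  Open   : ∀ {x y P P'} → P ─[ outA x y ]→ P' → ¬ (x ≡ y) → ν y P ─[ boutA x y ]→ P'
  Res    : ∀ {y μ P P'} → P ─[ μ ]→ P' → y ∉ nA μ → ν y P ─[ μ ]→ ν y P'
  Parˡ   : ∀ {μ P P' Q} → P ─[ μ ]→ P' → (∀ z → z ∈ bnA μ → z ∉ fn Q) →
           (P ∣ Q) ─[ μ ]→ (P' ∣ Q)
  Parʳ   : ∀ {μ P Q Q'} → Q ─[ μ ]→ Q' → (∀ z → z ∈ bnA μ → z ∉ fn P) →
           (P ∣ Q) ─[ μ ]→ (P ∣ Q')
  Comˡ   : ∀ {x y P P' Q Q'} → P ─[ inA x y ]→ P' → Q ─[ outA x y ]→ Q' →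
           (P ∣ Q) ─[ τ ]→ (P' ∣ Q')
  Comʳ   : ∀ {x y P P' Q Q'} → P ─[ outA x y ]→ P' → Q ─[ inA x y ]→ Q' →
           (P ∣ Q) ─[ τ ]→ (P' ∣ Q')
  Closeˡ : ∀ {x y P P' Q Q'} → P ─[ inA x y ]→ P' → Q ─[ boutA x y ]→ Q' → y ∉ fn P →
           (P ∣ Q) ─[ τ ]→ ν y (P' ∣ Q')
  Closeʳ : ∀ {x y P P' Q Q'} → P ─[ boutA x y ]→ P' → Q ─[ inA x y ]→ Q' → y ∉ fn Q →
           (P ∣ Q) ─[ τ ]→ ν y (P' ∣ Q')
  Rep    : ∀ {μ P P'} → P ─[ μ ]→ P' → (! P) ─[ μ ]→ (P' ∣ (! P))
  Alpha  : ∀ {μ P P₁ P₂ P'} → P ≈P P₁ → P₁ ─[ μ ]→ P₂ → P₂ ≈P P' → P ─[ μ ]→ P'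

-- Labels ⟨s,n⟩ ∈ {0,1}* × ℕ   (0 = false, 1 = true)

Label : Set
Label = List Bool × ℕ

_⊑_ : List Bool → List Bool → Set
s₀ ⊑ s₁ = ∃ λ t → s₀ ++ t ≡ s₁

_ℜ_ : List Label → List Label → Set
L₀ ℜ L₁ = ∀ s₀ n₀ s₁ n₁ → (s₀ , n₀) ∈ L₀ → (s₁ , n₁) ∈ L₁ →
          ¬ (s₀ ⊑ s₁) × ¬ (s₁ ⊑ s₀)

data LTerm : Set where
  𝟘ₗ   : LTerm
  preₗ : Prefix → Label → LTerm → LTerm
  _∣ₗ_ : LTerm → LTerm → LTerm
  νₗ   : Name → LTerm → LTerm
  !ₗ   : Label → Proc → LTerm

Lab : Label → Proc → LTerm
Lab v 𝟘 = 𝟘ₗ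
Lab (s , n) (pre π P) = preₗ π (s , n) (Lab (s , suc n) P)
Lab (s , n) (P ∣ Q) = Lab (s ++ [ false ] , n) P ∣ₗ Lab (s ++ [ true ] , n) Q
Lab v (ν x P) = νₗ x (Lab v P)
Lab v (! P) = !ₗ v P

top : LTerm → List Label
top 𝟘ₗ = []
top (preₗ π v E) = [ v ]
top (E ∣ₗ F) = top E ++ top F
top (νₗ x E) = top E
top (!ₗ v P) = [ v ]

lab : LTerm → List Label
lab 𝟘ₗ = []
lab (preₗ π v E) = v ∷ lab E
lab (E ∣ₗ F) = lab E ++ lab F
lab (νₗ x E) = lab E
lab (!ₗ v P) = [ v ]

data wf : LTerm → Set where
  wf-𝟘   : wf 𝟘ₗ
  wf-pre : ∀ v π P → wf (Lab v (pre π P))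
  wf-par : ∀ {E F} → wf E → wf F → top E ℜ top F → wf (E ∣ₗ F)
  wf-ν   : ∀ {x E} → wf E → wf (νₗ x E)
  wf-!   : ∀ v P → wf (!ₗ v P)

fnₗ : LTerm → List Name
fnₗ 𝟘ₗ = []
fnₗ (preₗ (inP x y) v E) = x ∷ remove y (fnₗ E)
fnₗ (preₗ (outP x y) v E) = x ∷ y ∷ fnₗ E
fnₗ (E ∣ₗ F) = fnₗ E ++ fnₗ F
fnₗ (νₗ x E) = remove x (fnₗ E)
fnₗ (!ₗ v P) = fn P

subₗ : Subst → LTerm → LTerm
subₗ σ 𝟘ₗ = 𝟘ₗ
subₗ σ (preₗ (inP x y) v E) =
  let w = fresh σ (fnₗ (preₗ (inP x y) v E)) in preₗ (inP (σ x) w) v (subₗ (update σ y w) E)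
subₗ σ (preₗ (outP x y) v E) = preₗ (outP (σ x) (σ y)) v (subₗ σ E)
subₗ σ (E ∣ₗ F) = subₗ σ E ∣ₗ subₗ σ F
subₗ σ (νₗ x E) =
  let w = fresh σ (fnₗ (νₗ x E)) in νₗ w (subₗ (update σ x w) E)
subₗ σ (!ₗ v P) = !ₗ v (sub σ P)

_[_/_]ₗ : LTerm → Name → Name → LTerm
E [ z / y ]ₗ = subₗ (update idS y z) E

infix 4 _≈ₗ_
data _≈ₗ_ : LTerm → LTerm → Set where
  ≈refl  : ∀ {E} → E ≈ₗ E
  ≈sym   : ∀ {E F} → E ≈ₗ F → F ≈ₗ E
  ≈trans : ∀ {E F G} → E ≈ₗ F → F ≈ₗ G → E ≈ₗ G
  ≈pre   : ∀ {π v E F} → E ≈ₗ F → preₗ π v E ≈ₗ preₗ π v F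
  ≈par   : ∀ {E E' F F'} → E ≈ₗ E' → F ≈ₗ F' → (E ∣ₗ F) ≈ₗ (E' ∣ₗ F')
  ≈ν     : ∀ {x E F} → E ≈ₗ F → νₗ x E ≈ₗ νₗ x F
  ≈!     : ∀ {v P Q} → P ≈P Q → !ₗ v P ≈ₗ !ₗ v Q
  α-ν    : ∀ {x y E} → y ∉ fnₗ (νₗ x E) → νₗ x E ≈ₗ νₗ y (E [ y / x ]ₗ)
  α-in   : ∀ {x y z v E} → z ∉ fnₗ (preₗ (inP x y) v E) →
           preₗ (inP x y) v E ≈ₗ preₗ (inP x z) v (E [ z / y ]ₗ)

-- Labeled transitions: unlabeled rules with labels ignored, except Rep.
infix 3 _─[_]→ₗ_
data _─[_]→ₗ_ : LTerm → Act → LTerm → Set where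
  Input  : ∀ {x y z v E} → preₗ (inP x y) v E ─[ inA x z ]→ₗ (E [ z / y ]ₗ)
  Output : ∀ {x y v E} → preₗ (outP x y) v E ─[ outA x y ]→ₗ E
  Open   : ∀ {x y E E'} → E ─[ outA x y ]→ₗ E' → ¬ (x ≡ y) → νₗ y E ─[ boutA x y ]→ₗ E'
  Res    : ∀ {y μ E E'} → E ─[ μ ]→ₗ E' → y ∉ nA μ → νₗ y E ─[ μ ]→ₗ νₗ y E'
  Parˡ   : ∀ {μ E E' F} → E ─[ μ ]→ₗ E' → (∀ z → z ∈ bnA μ → z ∉ fnₗ F) →
           (E ∣ₗ F) ─[ μ ]→ₗ (E' ∣ₗ F)
  Parʳ   : ∀ {μ E F F'} → F ─[ μ ]→ₗ F' → (∀ z → z ∈ bnA μ → z ∉ fnₗ E) →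
           (E ∣ₗ F) ─[ μ ]→ₗ (E ∣ₗ F')
  Comˡ   : ∀ {x y E E' F F'} → E ─[ inA x y ]→ₗ E' → F ─[ outA x y ]→ₗ F' →
           (E ∣ₗ F) ─[ τ ]→ₗ (E' ∣ₗ F')
  Comʳ   : ∀ {x y E E' F F'} → E ─[ outA x y ]→ₗ E' → F ─[ inA x y ]→ₗ F' →
           (E ∣ₗ F) ─[ τ ]→ₗ (E' ∣ₗ F')
  Closeˡ : ∀ {x y E E' F F'} → E ─[ inA x y ]→ₗ E' → F ─[ boutA x y ]→ₗ F' → y ∉ fnₗ E →
           (E ∣ₗ F) ─[ τ ]→ₗ νₗ y (E' ∣ₗ F')
  Closeʳ : ∀ {x y E E' F F'} → E ─[ boutA x y ]→ₗ E' → F ─[ inA x y ]→ₗ F' → y ∉ fnₗ F →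
           (E ∣ₗ F) ─[ τ ]→ₗ νₗ y (E' ∣ₗ F')
  Rep    : ∀ {μ s n P P'} → P ─[ μ ]→ P' →
           !ₗ (s , n) P ─[ μ ]→ₗ (Lab (s ++ [ false ] , suc n) P' ∣ₗ !ₗ (s ++ [ true ] , suc n) P)
  Alpha  : ∀ {μ E E₁ E₂ E'} → E ≈ₗ E₁ → E₁ ─[ μ ]→ₗ E₂ → E₂ ≈ₗ E' → E ─[ μ ]→ₗ E'

-- A transition consumes only prefixes or replications sitting at the top of
-- the term; everything below them is carried over, possibly renamed, and
-- renaming (substitution, α-conversion) never touches labels.  So a label of
-- E that is not a label of E' must have been on top.
module Submission where

open import Defs
open import Data.List.Membership.Propositional using (_∈_; _∉_)
open import Data.List using (_∷_; _++_)
open import Data.List.Membership.Propositional.Properties using (∈-++⁻; ∈-++⁺ˡ; ∈-++⁺ʳ)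
open import Data.List.Relation.Unary.Any using (here; there)
open import Data.Sum using (_⊎_; inj₁; inj₂; [_,_]; map)
open import Data.Empty using (⊥-elim)
open import Function using (_∘_; _$_; id)
open import Relation.Binary.PropositionalEquality using (_≡_; refl; sym; trans; cong; cong₂; subst)

lab-subₗ : ∀ σ E → lab (subₗ σ E) ≡ lab E
lab-subₗ σ 𝟘ₗ = refl
lab-subₗ σ (preₗ (inP x y) v E) = cong (v ∷_) (lab-subₗ _ E)
lab-subₗ σ (preₗ (outP x y) v E) = cong (v ∷_) (lab-subₗ σ E)
lab-subₗ σ (E ∣ₗ F) = cong₂ _++_ (lab-subₗ σ E) (lab-subₗ σ F)
lab-subₗ σ (νₗ x E) = lab-subₗ _ E
lab-subₗ σ (!ₗ v P) = refl

top-subₗ : ∀ σ E → top (subₗ σ E) ≡ top E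
top-subₗ σ 𝟘ₗ = refl
top-subₗ σ (preₗ (inP x y) v E) = refl
top-subₗ σ (preₗ (outP x y) v E) = refl
top-subₗ σ (E ∣ₗ F) = cong₂ _++_ (top-subₗ σ E) (top-subₗ σ F)
top-subₗ σ (νₗ x E) = top-subₗ _ E
top-subₗ σ (!ₗ v P) = refl

lab-≈ₗ : ∀ {E F} → E ≈ₗ F → lab E ≡ lab F
lab-≈ₗ ≈refl = refl
lab-≈ₗ (≈sym p) = sym (lab-≈ₗ p)
lab-≈ₗ (≈trans p q) = trans (lab-≈ₗ p) (lab-≈ₗ q)
lab-≈ₗ (≈pre {v = v} p) = cong (v ∷_) (lab-≈ₗ p)
lab-≈ₗ (≈par p q) = cong₂ _++_ (lab-≈ₗ p) (lab-≈ₗ q)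
lab-≈ₗ (≈ν p) = lab-≈ₗ p
lab-≈ₗ (≈! _) = refl
lab-≈ₗ (α-ν {E = E} _) = sym (lab-subₗ _ E)
lab-≈ₗ (α-in {v = v} {E = E} _) = cong (v ∷_) (sym (lab-subₗ _ E))

top-≈ₗ : ∀ {E F} → E ≈ₗ F → top E ≡ top F
top-≈ₗ ≈refl = refl
top-≈ₗ (≈sym p) = sym (top-≈ₗ p)
top-≈ₗ (≈trans p q) = trans (top-≈ₗ p) (top-≈ₗ q)
top-≈ₗ (≈pre _) = refl
top-≈ₗ (≈par p q) = cong₂ _++_ (top-≈ₗ p) (top-≈ₗ q)
top-≈ₗ (≈ν p) = top-≈ₗ p
top-≈ₗ (≈! _) = refl
top-≈ₗ (α-ν {E = E} _) = sym (top-subₗ _ E)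
top-≈ₗ (α-in _) = refl

record Persists (E E' : LTerm) : Set where
  constructor persists
  field survive-or-top : ∀ {v} → v ∈ lab E → v ∈ lab E' ⊎ v ∈ top E
open Persists

persists-refl : ∀ {E} → Persists E E
persists-refl = persists inj₁

persists-νˡ : ∀ {x E E'} → Persists E E' → Persists (νₗ x E) E'
persists-νˡ (persists p) = persists p

persists-νʳ : ∀ {x E E'} → Persists E E' → Persists E (νₗ x E')
persists-νʳ (persists p) = persists p

persists-ν : ∀ {x E E'} → Persists E E' → Persists (νₗ x E) (νₗ x E')
persists-ν = persists-νˡ ∘ persists-νʳ

persists-par : ∀ {E E' F F'} → Persists E E' → Persists F F' →
               Persists (E ∣ₗ F) (E' ∣ₗ F')
persists-par {E} {E'} (persists p) (persists q) = persists λ m →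
  [ map ∈-++⁺ˡ ∈-++⁺ˡ ∘ p , map (∈-++⁺ʳ (lab E')) (∈-++⁺ʳ (top E)) ∘ q ] (∈-++⁻ (lab E) m)

persists-≈ₗ : ∀ {E E₁ E₂ E'} → E ≈ₗ E₁ → Persists E₁ E₂ → E₂ ≈ₗ E' → Persists E E'
persists-≈ₗ p (persists t) q = persists λ m →
  map (subst (_ ∈_) (lab-≈ₗ q)) (subst (_ ∈_) (sym (top-≈ₗ p))) (t (subst (_ ∈_) (lab-≈ₗ p) m))

persists-step : ∀ {E E' μ} → E ─[ μ ]→ₗ E' → Persists E E'
persists-step (Input {E = E}) = persists λ where
  (here p) → inj₂ (here p)
  (there m) → inj₁ (subst (_ ∈_) (sym (lab-subₗ _ E)) m)
persists-step Output = persists λ where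
  (here p) → inj₂ (here p)
  (there m) → inj₁ m
persists-step (Open t _) = persists-νˡ (persists-step t)
persists-step (Res t _) = persists-ν (persists-step t)
persists-step (Parˡ t _) = persists-par (persists-step t) persists-refl
persists-step (Parʳ t _) = persists-par persists-refl (persists-step t)
persists-step (Comˡ t u) = persists-par (persists-step t) (persists-step u)
persists-step (Comʳ t u) = persists-par (persists-step t) (persists-step u)
persists-step (Closeˡ t u _) = persists-νʳ $ persists-par (persists-step t) (persists-step u)
persists-step (Closeʳ t u _) = persists-νʳ $ persists-par (persists-step t) (persists-step u)
persists-step (Rep _) = persists inj₂
persists-step (Alpha p t q) = persists-≈ₗ p (persists-step t) q

lemmaA7 : ∀ {E E' : LTerm} {μ : Act} {v : Label} →
          wf E → wf E' → E ─[ μ ]→ₗ E' →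
          v ∈ lab E → v ∉ lab E' → v ∈ top E
lemmaA7 _ _ t m v∉E' = [ ⊥-elim ∘ v∉E' , id ] (survive-or-top (persists-step t) m)
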